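{- There is a universal constant $\beta_0$ such that the following holds for every $\beta\ge\beta_0$. Let $\epsilon\in(0,\tfrac12]$, $\delta\in(0,1)$, $c=80/\delta$, $s=\frac{\beta}{\delta^3\epsilon^4}$, and assume $m\ge K\epsilon^{ -11}\delta^{ -7}$ for a sufficiently large constant $K$. Let $F$ consist of $s$ edges, each drawn independently and uniformly at random from $E$ (with replacement), and let $\tilde H=\bigcup_{(u,v)\in F}\{u,v\}$. Then with probability at least $1-\frac{\delta}{4}$, $\tilde H$ contains every vertex $v$ with $\deg(v)\ge\epsilon^2m/c$.
   Context: $G=(V,E)$ is an undirected, unweighted, simple graph with $m$ edges; $\deg(v)$ is the degree of $v$. (In the paper $F$ is the output of $s$ independent $\ell_0$-samplers run over a dynamic stream, each returning a uniformly random edge of the final graph.)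
   Formalization: The parameters β, ε and δ range over the rationals, and the constants β₀ and K are taken to be rational as well. -}

module Defs where

open import Data.Nat as ℕ using (ℕ; zero; suc)
open import Data.Integer as ℤ using (ℤ)
open import Data.Rational as ℚ using (ℚ; 0ℚ; 1ℚ; _<_; _≤_; _*_; _+_; _-_; _/_)
open import Data.Rational.Properties using (pos⇒nonZero; _≤?_)
open import Data.Fin using (Fin; toℕ)
open import Data.Fin.Properties using () renaming (_≟_ to _≟ᶠ_)
open import Data.Vec using (Vec; []; _∷_)
open import Data.List as List using (List; []; _∷_; length; filter; allFin; concatMap; map)
open import Data.List.Relation.Unary.All using (All)
open import Data.List.Relation.Unary.Unique.Propositional using (Unique)
open import Data.Product using (_×_; _,_; proj₁; proj₂)
open import Data.Bool using (Bool; true; false; _∨_; _∧_; not; T)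
open import Relation.Nullary.Decidable using (does)
open import Relation.Unary using (Pred)

countB : {A : Set} → (A → Bool) → List A → ℕ
countB p []       = 0
countB p (x ∷ xs) = if′ (p x)
  where
  if′ : Bool → ℕ
  if′ true  = suc (countB p xs)
  if′ false = countB p xs

allB : {A : Set} → (A → Bool) → List A → Bool
allB p []       = true
allB p (x ∷ xs) = p x ∧ allB p xs

-- Each edge {u,v}
-- is stored once, as the ordered pair (u , v) with u < v (so no loops and
-- no orientation), and the edge list has no repetitions (no multi-edges).
record Graph : Set where
  field
    n       : ℕ
    edges   : List (Fin n × Fin n)
    ordered : All (λ e → toℕ (proj₁ e) ℕ.< toℕ (proj₂ e)) edges
    unique  : Unique edges

module _ (G : Graph) where
  open Graph G

  numEdges : ℕ
  numEdges = length edges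

  incident : Fin n → Fin n × Fin n → Bool
  incident v (a , b) = does (v ≟ᶠ a) ∨ does (v ≟ᶠ b)

  degree : Fin n → ℕ
  degree v = countB (incident v) edges

  edgeAt : Fin numEdges → Fin n × Fin n
  edgeAt = List.lookup edges

  inCover : {s : ℕ} → Vec (Fin numEdges) s → Fin n → Bool
  inCover []       v = false
  inCover (i ∷ is) v = incident v (edgeAt i) ∨ inCover is v

-- all vectors of length s over Fin m: the sample space of s independent
-- uniform draws (with replacement) from m items; it has m ^ s elements,
-- each of equal probability
allVecs : (m s : ℕ) → List (Vec (Fin m) s)
allVecs m zero    = [] ∷ []
allVecs m (suc s) = concatMap (λ i → map (i ∷_) (allVecs m s)) (allFin m)

ℕ→ℚ : ℕ → ℚ
ℕ→ℚ k = ℤ.+ k / 1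

_^_ : ℚ → ℕ → ℚ
p ^ zero  = 1ℚ
p ^ suc k = p * (p ^ k)

inv : (p : ℚ) → 0ℚ < p → ℚ
inv p 0<p = ℚ.1/_ p {{pos⇒nonZero p {{ℚ.positive 0<p}}}}

-- ⌈ q ⌉ as a natural number (used for q ≥ 0)
ceilℕ : ℚ → ℕ
ceilℕ q = ℤ.∣ ℚ.ceiling q ∣

module _ (G : Graph) (ε δ : ℚ) where
  open Graph G

  -- deg(v) ≥ ε² m / c  with c = 80/δ, i.e. deg(v) ≥ ε² m δ / 80
  heavy : Fin n → Bool
  heavy v = does ((ε ^ 2) * ℕ→ℚ (numEdges G) * δ * (ℤ.+ 1 / 80) ≤? ℕ→ℚ (degree G v))

  goodSample : {s : ℕ} → Vec (Fin (numEdges G)) s → Bool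
  goodSample F = allB (λ v → not (heavy v) ∨ inCover G F v) (allFin n)

  -- Pr[good event] = (number of good samples) / m^s ; we state it as a
  -- rational number (when m ≥ 1)
  goodCount : ℕ → ℕ
  goodCount s = countB goodSample (allVecs (numEdges G) s)

-- A vertex of degree d is missed by exactly (m − d)ˢ of the mˢ sample vectors, and a
-- Bernoulli-type inequality gives (m − d)ˢ · s d ≤ mˢ⁺¹.  Take a union bound over the heavy
-- vertices, weighting each by d² / T² ≥ 1, where T = ε² m δ / 80 is the heaviness threshold:
-- the number of bad samples times s T² is at most mˢ⁺¹ · Σᵥ deg v = 2 mˢ⁺² (handshake lemma).
-- So the bad fraction is at most 12800 / (s ε⁴ δ²), which is ≤ δ / 4 once s ε⁴ δ³ ≥ 51200.
module Submission where

open import Defs hiding (_^_)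
open import Data.Bool using (Bool; true; false; not; _∧_; _∨_; T; if_then_else_)
open import Data.Bool.Properties using (∨-∧-booleanAlgebra)
open import Data.Empty using (⊥-elim)
open import Data.Fin using (Fin)
open import Data.Fin.Properties using () renaming (_≟_ to _≟ᶠ_)
open import Data.List as List using (List; []; _∷_; _++_; length; map; allFin; concatMap)
import Data.List.Properties as List
open import Data.List.Relation.Unary.All using (All; []; _∷_)
open import Data.List.Relation.Unary.AllPairs using ([]; _∷_)
open import Data.List.Relation.Unary.Unique.Propositional using (Unique)
open import Data.List.Relation.Unary.Unique.Propositional.Properties using (allFin⁺)
open import Data.Nat as ℕ using (ℕ; zero; suc; _∸_; z≤n; s≤s)
open import Data.Nat.ListAction using (sum)
import Data.Nat.Properties as ℕP
import Data.Nat.Solver as ℕS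
open import Data.Product using (_×_; _,_)
open import Data.Rational using (ℚ)
open import Data.Unit using (tt)
open import Data.Vec using (Vec; []; _∷_; toList)
open import Relation.Binary.Definitions using (DecidableEquality)
open import Relation.Binary.PropositionalEquality
open import Relation.Nullary using (Dec; yes; no; does)

open import Algebra.Lattice.Properties.BooleanAlgebra ∨-∧-booleanAlgebra using (deMorgan₁)
open import Algebra.Properties.CommutativeSemigroup ℕP.+-commutativeSemigroup using (interchange)

indicator : Bool → ℕ
indicator true  = 1
indicator false = 0

module _ {A : Set} where
  open import Data.Nat using (_+_; _*_; _≤_)

  countB-∷ : (p : A → Bool) (x : A) (xs : List A) → countB p (x ∷ xs) ≡ indicator (p x) + countB p xs
  countB-∷ p x xs with p x
  ... | true  = refl
  ... | false = refl

  countB-false : (xs : List A) → countB (λ _ → false) xs ≡ 0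
  countB-false []       = refl
  countB-false (_ ∷ xs) = countB-false xs

  countB-true : (xs : List A) → countB (λ _ → true) xs ≡ length xs
  countB-true []       = refl
  countB-true (_ ∷ xs) = cong suc (countB-true xs)

  allB-true : (xs : List A) → allB (λ _ → true) xs ≡ true
  allB-true []       = refl
  allB-true (_ ∷ xs) = allB-true xs

  countB-cong : {p q : A → Bool} → (∀ x → p x ≡ q x) → (xs : List A) → countB p xs ≡ countB q xs
  countB-cong         p≗q []       = refl
  countB-cong {p} {q} p≗q (x ∷ xs) = begin
    countB p (x ∷ xs)                ≡⟨ countB-∷ p x xs ⟩
    indicator (p x) + countB p xs    ≡⟨ cong₂ _+_ (cong indicator (p≗q x)) (countB-cong p≗q xs) ⟩
    indicator (q x) + countB q xs    ≡⟨ countB-∷ q x xs ⟨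
    countB q (x ∷ xs)                ∎
    where open ≡-Reasoning

  countB-++ : (p : A → Bool) (xs ys : List A) → countB p (xs ++ ys) ≡ countB p xs + countB p ys
  countB-++ p []       ys = refl
  countB-++ p (x ∷ xs) ys with p x
  ... | true  = cong suc (countB-++ p xs ys)
  ... | false = countB-++ p xs ys

  countB-∨ : (p q : A → Bool) (xs : List A) → countB (λ x → p x ∨ q x) xs ≤ countB p xs + countB q xs
  countB-∨ p q []       = z≤n
  countB-∨ p q (x ∷ xs) with p x | q x
  ... | true  | true  = s≤s (ℕP.≤-trans (countB-∨ p q xs) (ℕP.+-monoʳ-≤ (countB p xs) (ℕP.n≤1+n _)))
  ... | true  | false = s≤s (countB-∨ p q xs)
  ... | false | true  = ℕP.≤-trans (s≤s (countB-∨ p q xs)) (ℕP.≤-reflexive (sym (ℕP.+-suc _ _)))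
  ... | false | false = countB-∨ p q xs

  countB+countB-not : (p : A → Bool) (xs : List A) → countB p xs + countB (λ x → not (p x)) xs ≡ length xs
  countB+countB-not p []       = refl
  countB+countB-not p (x ∷ xs) with p x
  ... | true  = cong suc (countB+countB-not p xs)
  ... | false = trans (ℕP.+-suc (countB p xs) _) (cong suc (countB+countB-not p xs))

  countB-≤-length : (p : A → Bool) (xs : List A) → countB p xs ≤ length xs
  countB-≤-length p xs = ℕP.≤-trans (ℕP.m≤m+n _ _) (ℕP.≤-reflexive (countB+countB-not p xs))

  countB-const-∧ : (b : Bool) (p : A → Bool) (xs : List A) → countB (λ x → b ∧ p x) xs ≡ indicator b * countB p xs
  countB-const-∧ true  p xs = sym (ℕP.+-identityʳ _)
  countB-const-∧ false p xs = countB-false xs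

  sum-map-mono : {f g : A → ℕ} → (∀ x → f x ≤ g x) → (xs : List A) → sum (map f xs) ≤ sum (map g xs)
  sum-map-mono f≤g []       = z≤n
  sum-map-mono f≤g (x ∷ xs) = ℕP.+-mono-≤ (f≤g x) (sum-map-mono f≤g xs)

  sum-map-+ : (f g : A → ℕ) (xs : List A) → sum (map (λ x → f x + g x) xs) ≡ sum (map f xs) + sum (map g xs)
  sum-map-+ f g []       = refl
  sum-map-+ f g (x ∷ xs) = begin
    f x + g x + sum (map (λ x → f x + g x) xs)   ≡⟨ cong (f x + g x +_) (sum-map-+ f g xs) ⟩
    f x + g x + (sum (map f xs) + sum (map g xs)) ≡⟨ interchange (f x) (g x) _ _ ⟩
    f x + sum (map f xs) + (g x + sum (map g xs)) ∎
    where open ≡-Reasoning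

  sum-map-*ˡ : (c : ℕ) (f : A → ℕ) (xs : List A) → sum (map (λ x → c * f x) xs) ≡ c * sum (map f xs)
  sum-map-*ˡ c f []       = sym (ℕP.*-zeroʳ c)
  sum-map-*ˡ c f (x ∷ xs) = trans (cong (c * f x +_) (sum-map-*ˡ c f xs)) (sym (ℕP.*-distribˡ-+ c (f x) _))

  sum-map-const : (k : ℕ) (xs : List A) → sum (map (λ _ → k) xs) ≡ length xs * k
  sum-map-const k []       = refl
  sum-map-const k (_ ∷ xs) = cong (k +_) (sum-map-const k xs)

  sum-map-indicator : (p : A → Bool) (xs : List A) → sum (map (λ x → indicator (p x)) xs) ≡ countB p xs
  sum-map-indicator p []       = refl
  sum-map-indicator p (x ∷ xs) = trans (cong (indicator (p x) +_) (sum-map-indicator p xs)) (sym (countB-∷ p x xs))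

module _ {A B : Set} where
  open import Data.Nat using (_+_)

  countB-map : (p : B → Bool) (f : A → B) (xs : List A) → countB p (map f xs) ≡ countB (λ x → p (f x)) xs
  countB-map p f []       = refl
  countB-map p f (x ∷ xs) = begin
    countB p (f x ∷ map f xs)                       ≡⟨ countB-∷ p (f x) (map f xs) ⟩
    indicator (p (f x)) + countB p (map f xs)       ≡⟨ cong (indicator (p (f x)) +_) (countB-map p f xs) ⟩
    indicator (p (f x)) + countB (λ x → p (f x)) xs ≡⟨ countB-∷ (λ x → p (f x)) x xs ⟨
    countB (λ x → p (f x)) (x ∷ xs)                 ∎
    where open ≡-Reasoning

  sum-map-countB-comm : (R : A → B → Bool) (xs : List A) (ys : List B) →
    sum (map (λ x → countB (R x) ys) xs) ≡ sum (map (λ y → countB (λ x → R x y) xs) ys)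
  sum-map-countB-comm R xs []       = trans (sum-map-const 0 xs) (ℕP.*-zeroʳ (length xs))
  sum-map-countB-comm R xs (y ∷ ys) = begin
    sum (map (λ x → countB (R x) (y ∷ ys)) xs)                                ≡⟨ cong sum (List.map-cong (λ x → countB-∷ (R x) y ys) xs) ⟩
    sum (map (λ x → indicator (R x y) + countB (R x) ys) xs)                  ≡⟨ sum-map-+ _ _ xs ⟩
    sum (map (λ x → indicator (R x y)) xs) + sum (map (λ x → countB (R x) ys) xs)
      ≡⟨ cong₂ _+_ (sum-map-indicator (λ x → R x y) xs) (sum-map-countB-comm R xs ys) ⟩
    countB (λ x → R x y) xs + sum (map (λ y → countB (λ x → R x y) xs) ys)   ∎
    where open ≡-Reasoning

module _ {A : Set} (_≟_ : DecidableEquality A) (a : A) where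
  open import Data.Nat using (_≤_)

  countB-≟-absent : {xs : List A} → All (a ≢_) xs → countB (λ y → does (y ≟ a)) xs ≡ 0
  countB-≟-absent []                    = refl
  countB-≟-absent {y ∷ _} (a≢y ∷ a∉xs) with y ≟ a
  ... | yes refl = ⊥-elim (a≢y refl)
  ... | no _     = countB-≟-absent a∉xs

  countB-≟-unique : {xs : List A} → Unique xs → countB (λ y → does (y ≟ a)) xs ≤ 1
  countB-≟-unique []                  = z≤n
  countB-≟-unique {y ∷ _} (y∉xs ∷ xs!) with y ≟ a
  ... | yes refl = ℕP.≤-reflexive (cong suc (countB-≟-absent y∉xs))
  ... | no _     = countB-≟-unique xs!

module _ {m : ℕ} (q : Fin m → Bool) where
  open import Data.Nat using (_+_; _*_; _^_)

  countB-allB-prepend : {s : ℕ} (L : List (Fin m)) (Fs : List (Vec (Fin m) s)) →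
    countB (λ F → allB q (toList F)) (concatMap (λ i → map (i ∷_) Fs) L)
      ≡ countB q L * countB (λ F → allB q (toList F)) Fs
  countB-allB-prepend []      Fs = refl
  countB-allB-prepend (i ∷ L) Fs = begin
    countB P (map (i ∷_) Fs ++ concatMap (λ i → map (i ∷_) Fs) L)  ≡⟨ countB-++ P (map (i ∷_) Fs) _ ⟩
    countB P (map (i ∷_) Fs) + countB P (concatMap (λ i → map (i ∷_) Fs) L)
      ≡⟨ cong₂ _+_ (trans (countB-map P (i ∷_) Fs) (countB-const-∧ (q i) P Fs)) (countB-allB-prepend L Fs) ⟩
    indicator (q i) * countB P Fs + countB q L * countB P Fs        ≡⟨ ℕP.*-distribʳ-+ (countB P Fs) (indicator (q i)) _ ⟨
    (indicator (q i) + countB q L) * countB P Fs                    ≡⟨ cong (_* countB P Fs) (countB-∷ q i L) ⟨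
    countB q (i ∷ L) * countB P Fs                                  ∎
    where
    open ≡-Reasoning
    P : {k : ℕ} → Vec (Fin m) k → Bool
    P F = allB q (toList F)

  countB-allB-allVecs : (s : ℕ) → countB (λ F → allB q (toList F)) (allVecs m s) ≡ countB q (allFin m) ^ s
  countB-allB-allVecs zero    = refl
  countB-allB-allVecs (suc s) =
    trans (countB-allB-prepend (allFin m) (allVecs m s)) (cong (countB q (allFin m) *_) (countB-allB-allVecs s))

length-allVecs : (m s : ℕ) → length (allVecs m s) ≡ m ℕ.^ s
length-allVecs m s = begin
  length (allVecs m s)                                         ≡⟨ countB-true (allVecs m s) ⟨
  countB (λ _ → true) (allVecs m s)                            ≡⟨ countB-cong (λ F → allB-true (toList F)) (allVecs m s) ⟨
  countB (λ F → allB (λ _ → true) (toList F)) (allVecs m s)    ≡⟨ countB-allB-allVecs (λ _ → true) s ⟩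
  countB (λ _ → true) (allFin m) ℕ.^ s                         ≡⟨ cong (ℕ._^ s) (trans (countB-true (allFin m)) (List.length-tabulate _)) ⟩
  m ℕ.^ s                                                      ∎
  where open ≡-Reasoning

module _ (G : Graph) where
  open Graph G
  open import Data.Nat using (_+_; _*_; _^_; _≤_)

  degree-≤-numEdges : ∀ v → degree G v ≤ numEdges G
  degree-≤-numEdges v = countB-≤-length (incident G v) edges

  incidentVertexCount-≤-2 : (e : Fin n × Fin n) → countB (λ v → incident G v e) (allFin n) ≤ 2
  incidentVertexCount-≤-2 (a , b) = ℕP.≤-trans (countB-∨ _ _ (allFin n))
    (ℕP.+-mono-≤ (countB-≟-unique _≟ᶠ_ a (allFin⁺ n)) (countB-≟-unique _≟ᶠ_ b (allFin⁺ n)))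

  handshake : sum (map (degree G) (allFin n)) ≤ numEdges G * 2
  handshake = begin
    sum (map (degree G) (allFin n))                                    ≡⟨ sum-map-countB-comm (incident G) (allFin n) edges ⟩
    sum (map (λ e → countB (λ v → incident G v e) (allFin n)) edges)  ≤⟨ sum-map-mono incidentVertexCount-≤-2 edges ⟩
    sum (map (λ _ → 2) edges)                                          ≡⟨ sum-map-const 2 edges ⟩
    numEdges G * 2                                                     ∎
    where open ℕP.≤-Reasoning

  not-inCover : {s : ℕ} (F : Vec (Fin (numEdges G)) s) (v : Fin n) →
    not (inCover G F v) ≡ allB (λ i → not (incident G v (edgeAt G i))) (toList F)
  not-inCover []      v = refl
  not-inCover (i ∷ F) v with incident G v (edgeAt G i)
  ... | true  = refl
  ... | false = not-inCover F v

  nonIncidentEdgeCount : (v : Fin n) →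
    countB (λ i → not (incident G v (edgeAt G i))) (allFin (numEdges G)) ≡ numEdges G ∸ degree G v
  nonIncidentEdgeCount v = begin
    countB (λ i → not (incident G v (edgeAt G i))) (allFin (numEdges G))  ≡⟨ countB-map (λ e → not (incident G v e)) (edgeAt G) (allFin (numEdges G)) ⟨
    countB (λ e → not (incident G v e)) (map (edgeAt G) (allFin (numEdges G)))
      ≡⟨ cong (countB _) (trans (List.map-tabulate (λ i → i) (edgeAt G)) (List.tabulate-lookup edges)) ⟩
    countB (λ e → not (incident G v e)) edges                             ≡⟨ ℕP.m+n∸m≡n (degree G v) _ ⟨
    degree G v + countB (λ e → not (incident G v e)) edges ∸ degree G v  ≡⟨ cong (_∸ degree G v) (countB+countB-not (incident G v) edges) ⟩
    numEdges G ∸ degree G v                                               ∎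
    where open ≡-Reasoning

  missingSampleCount : (s : ℕ) (v : Fin n) →
    countB (λ F → not (inCover G F v)) (allVecs (numEdges G) s) ≡ (numEdges G ∸ degree G v) ^ s
  missingSampleCount s v = begin
    countB (λ F → not (inCover G F v)) (allVecs (numEdges G) s)  ≡⟨ countB-cong (λ F → not-inCover F v) (allVecs (numEdges G) s) ⟩
    countB (λ F → allB missesV (toList F)) (allVecs (numEdges G) s) ≡⟨ countB-allB-allVecs missesV s ⟩
    countB missesV (allFin (numEdges G)) ^ s                       ≡⟨ cong (_^ s) (nonIncidentEdgeCount v) ⟩
    (numEdges G ∸ degree G v) ^ s                                  ∎
    where
    open ≡-Reasoning
    missesV : Fin (numEdges G) → Bool
    missesV i = not (incident G v (edgeAt G i))

module _ {X V : Set} where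
  open import Data.Nat using (_+_; _≤_)

  countB-not-allB-≤ : (g : X → V → Bool) (xs : List X) (vs : List V) →
    countB (λ x → not (allB (g x) vs)) xs ≤ sum (map (λ v → countB (λ x → not (g x v)) xs) vs)
  countB-not-allB-≤ g xs []       = ℕP.≤-reflexive (countB-false xs)
  countB-not-allB-≤ g xs (v ∷ vs) = begin
    countB (λ x → not (g x v ∧ allB (g x) vs)) xs                            ≡⟨ countB-cong (λ x → deMorgan₁ (g x v) _) xs ⟩
    countB (λ x → not (g x v) ∨ not (allB (g x) vs)) xs                      ≤⟨ countB-∨ _ _ xs ⟩
    countB (λ x → not (g x v)) xs + countB (λ x → not (allB (g x) vs)) xs    ≤⟨ ℕP.+-monoʳ-≤ _ (countB-not-allB-≤ g xs vs) ⟩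
    countB (λ x → not (g x v)) xs + sum (map (λ v → countB (λ x → not (g x v)) xs) vs) ∎
    where open ℕP.≤-Reasoning

module _ (k d : ℕ) where
  open import Data.Nat using (_+_; _*_; _^_; _≤_)
  open ℕS.+-*-Solver

  -- (1 − x)ˢ (1 + s x) ≤ 1 for x = d / (k + d), with the denominators cleared.
  bernoulli : (s : ℕ) → k ^ s * (k + d + s * d) ≤ (k + d) ^ suc s
  bernoulli zero    = ℕP.≤-reflexive (solve 2 (λ k d → con 1 :* (k :+ d :+ con 0) := (k :+ d) :* con 1) refl k d)
  bernoulli (suc s) = begin
    k ^ suc s * (k + d + suc s * d)          ≡⟨ solve 4 (λ a k d e → k :* a :* (k :+ d :+ (d :+ e)) := a :* (k :* (k :+ d :+ (d :+ e)))) refl (k ^ s) k d (s * d) ⟩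
    k ^ s * (k * (k + d + (d + s * d)))      ≤⟨ ℕP.*-monoʳ-≤ (k ^ s) (ℕP.≤-trans (ℕP.m≤m+n _ _) (ℕP.≤-reflexive (expand (s * d)))) ⟩
    k ^ s * ((k + d) * (k + d + s * d))      ≡⟨ solve 3 (λ a b c → a :* (b :* c) := b :* (a :* c)) refl (k ^ s) (k + d) _ ⟩
    (k + d) * (k ^ s * (k + d + s * d))      ≤⟨ ℕP.*-monoʳ-≤ (k + d) (bernoulli s) ⟩
    (k + d) ^ suc (suc s)                    ∎
    where
    open ℕP.≤-Reasoning
    expand : ∀ e → k * (k + d + (d + e)) + d * (d + e) ≡ (k + d) * (k + d + e)
    expand = solve 3 (λ k d e → k :* (k :+ d :+ (d :+ e)) :+ d :* (d :+ e) := (k :+ d) :* (k :+ d :+ e)) refl k d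

module _ {m d : ℕ} where
  open import Data.Nat using (_+_; _*_; _^_; _≤_)

  bernoulli-∸ : (s : ℕ) → d ≤ m → (m ∸ d) ^ s * (s * d) ≤ m ^ suc s
  bernoulli-∸ s d≤m = begin
    (m ∸ d) ^ s * (s * d)                  ≤⟨ ℕP.*-monoʳ-≤ ((m ∸ d) ^ s) (ℕP.m≤n+m (s * d) (m ∸ d + d)) ⟩
    (m ∸ d) ^ s * (m ∸ d + d + s * d)      ≤⟨ bernoulli (m ∸ d) d s ⟩
    (m ∸ d + d) ^ suc s                    ≡⟨ cong (_^ suc s) (ℕP.m∸n+n≡m d≤m) ⟩
    m ^ suc s                              ∎
    where open ℕP.≤-Reasoning

module _ (G : Graph) (ε δ : ℚ) where
  open Graph G
  open import Data.Nat using (_+_; _^_; _≤_)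

  badCount : ℕ → ℕ
  badCount s = countB (λ F → not (goodSample G ε δ F)) (allVecs (numEdges G) s)

  goodCount+badCount : (s : ℕ) → goodCount G ε δ s + badCount s ≡ numEdges G ^ s
  goodCount+badCount s = trans (countB+countB-not (goodSample G ε δ) (allVecs (numEdges G) s)) (length-allVecs (numEdges G) s)

  missedIfHeavy : ℕ → Fin n → ℕ
  missedIfHeavy s v = if heavy G ε δ v then (numEdges G ∸ degree G v) ^ s else 0

  badCount-≤ : (s : ℕ) → badCount s ≤ sum (map (missedIfHeavy s) (allFin n))
  badCount-≤ s = ℕP.≤-trans (countB-not-allB-≤ (λ F v → not (heavy G ε δ v) ∨ inCover G F v) (allVecs (numEdges G) s) (allFin n))
    (sum-map-mono missed-≤ (allFin n))
    where
    missed-≤ : (v : Fin n) → countB (λ F → not (not (heavy G ε δ v) ∨ inCover G F v)) (allVecs (numEdges G) s) ≤ missedIfHeavy s v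
    missed-≤ v with heavy G ε δ v
    ... | true  = ℕP.≤-reflexive (missingSampleCount G s v)
    ... | false = ℕP.≤-reflexive (countB-false (allVecs (numEdges G) s))

open import Defs using (_^_)
open import Data.Integer as ℤ using (-[1+_])
import Data.Integer.DivMod as ℤD
import Data.Integer.Properties as ℤP
open import Data.Nat.Coprimality using (1-coprimeTo) renaming (sym to coprime-sym)
open import Data.Rational as ℚ using (mkℚ; 0ℚ; 1ℚ; _<_; _≤_; _*_; _+_; _-_; _/_; *≤*)
import Data.Rational.Properties as ℚP
import Data.Rational.Solver as ℚS
open import Data.Product using (∃-syntax)

ℕ→ℚ≡mkℚ : ∀ k → ℕ→ℚ k ≡ mkℚ (ℤ.+ k) 0 (coprime-sym (1-coprimeTo k))
ℕ→ℚ≡mkℚ k = ℚP.normalize-coprime (coprime-sym (1-coprimeTo k))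

ℕ→ℚ-+ : ∀ a b → ℕ→ℚ (a ℕ.+ b) ≡ ℕ→ℚ a + ℕ→ℚ b
ℕ→ℚ-+ a b rewrite ℕ→ℚ≡mkℚ a | ℕ→ℚ≡mkℚ b =
  cong (_/ 1) (sym (cong₂ ℤ._+_ (ℤP.*-identityʳ (ℤ.+ a)) (ℤP.*-identityʳ (ℤ.+ b))))

ℕ→ℚ-* : ∀ a b → ℕ→ℚ (a ℕ.* b) ≡ ℕ→ℚ a * ℕ→ℚ b
ℕ→ℚ-* a b rewrite ℕ→ℚ≡mkℚ a | ℕ→ℚ≡mkℚ b = cong (_/ 1) (ℤP.pos-* a b)

ℕ→ℚ-mono-≤ : ∀ {a b} → a ℕ.≤ b → ℕ→ℚ a ≤ ℕ→ℚ b
ℕ→ℚ-mono-≤ {a} {b} a≤b rewrite ℕ→ℚ≡mkℚ a | ℕ→ℚ≡mkℚ b = *≤* (ℤP.*-monoʳ-≤-nonNeg (ℤ.+ 1) (ℤ.+≤+ a≤b))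

0≤ℕ→ℚ : ∀ k → 0ℚ ≤ ℕ→ℚ k
0≤ℕ→ℚ k = ℕ→ℚ-mono-≤ {0} {k} z≤n

private
  i≤+∣i∣ : ∀ i → i ℤ.≤ ℤ.+ ℤ.∣ i ∣
  i≤+∣i∣ (ℤ.+ _)  = ℤP.≤-refl
  i≤+∣i∣ -[1+ _ ] = ℤ.-≤+

  -- q ≤ ⌈q⌉ for q = i / (1 + d), cross-multiplied, with ⌈q⌉ = − ⌊− q⌋ as in Data.Rational.
  ≤-ceiling-* : ∀ i d → i ℤ.* ℤ.+ 1 ℤ.≤ ℤ.+ ℤ.∣ ℤ.- ((ℤ.- i) ℤD./ ℤ.+ suc d) ∣ ℤ.* ℤ.+ suc d
  ≤-ceiling-* i d = begin
    i ℤ.* ℤ.+ 1                    ≡⟨ ℤP.*-identityʳ i ⟩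
    i                              ≡⟨ ℤP.neg-involutive i ⟨
    ℤ.- (ℤ.- i)                    ≤⟨ ℤP.neg-mono-≤ f*d≤-i ⟩
    ℤ.- (f ℤ.* ℤ.+ suc d)          ≡⟨ ℤP.neg-distribˡ-* f (ℤ.+ suc d) ⟩
    ℤ.- f ℤ.* ℤ.+ suc d            ≤⟨ ℤP.*-monoʳ-≤-nonNeg (ℤ.+ suc d) (i≤+∣i∣ (ℤ.- f)) ⟩
    ℤ.+ ℤ.∣ ℤ.- f ∣ ℤ.* ℤ.+ suc d  ∎
    where
    open ℤP.≤-Reasoning
    f = (ℤ.- i) ℤD./ ℤ.+ suc d
    f*d≤-i : f ℤ.* ℤ.+ suc d ℤ.≤ ℤ.- i
    f*d≤-i = ℤP.≤-trans (ℤP.i≤j+i _ (ℤ.+ (ℤ.- i ℤD.% ℤ.+ suc d))) (ℤP.≤-reflexive (sym (ℤD.a≡a%n+[a/n]*n (ℤ.- i) (ℤ.+ suc d))))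

-- The numerator is split into constructors so that the negation inside ceiling computes.
ceilℕ-≥ : ∀ q → q ≤ ℕ→ℚ (ceilℕ q)
ceilℕ-≥ q@(mkℚ (ℤ.+ 0)     d _) rewrite ℕ→ℚ≡mkℚ (ceilℕ q) = *≤* (≤-ceiling-* (ℤ.+ 0) d)
ceilℕ-≥ q@(mkℚ (ℤ.+ suc n) d _) rewrite ℕ→ℚ≡mkℚ (ceilℕ q) = *≤* (≤-ceiling-* (ℤ.+ suc n) d)
ceilℕ-≥ q@(mkℚ -[1+ n ]   d _) rewrite ℕ→ℚ≡mkℚ (ceilℕ q) = *≤* (≤-ceiling-* -[1+ n ] d)

module _ {p q r : ℚ} where

  *-monoˡ-≤-≥0 : 0ℚ ≤ r → p ≤ q → r * p ≤ r * q
  *-monoˡ-≤-≥0 0≤r = ℚP.*-monoˡ-≤-nonNeg r {{ℚ.nonNegative 0≤r}}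

  *-monoʳ-≤-≥0 : 0ℚ ≤ r → p ≤ q → p * r ≤ q * r
  *-monoʳ-≤-≥0 0≤r = ℚP.*-monoʳ-≤-nonNeg r {{ℚ.nonNegative 0≤r}}

*-≥0 : ∀ {p q} → 0ℚ ≤ p → 0ℚ ≤ q → 0ℚ ≤ p * q
*-≥0 {p} {q} 0≤p 0≤q = ℚP.≤-trans (ℚP.≤-reflexive (sym (ℚP.*-zeroˡ q))) (*-monoʳ-≤-≥0 0≤q 0≤p)

^-≥0 : ∀ {p} k → 0ℚ ≤ p → 0ℚ ≤ p ^ k
^-≥0 zero    0≤p = 0≤ℕ→ℚ 1
^-≥0 (suc k) 0≤p = *-≥0 0≤p (^-≥0 k 0≤p)

*-self-mono-≤ : ∀ {p q} → 0ℚ ≤ p → p ≤ q → p * p ≤ q * q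
*-self-mono-≤ 0≤p p≤q = ℚP.≤-trans (*-monoˡ-≤-≥0 0≤p p≤q) (*-monoʳ-≤-≥0 (ℚP.≤-trans 0≤p p≤q) p≤q)

module _ {A : Set} (f g : A → ℕ) {c : ℚ} (0≤c : 0ℚ ≤ c) (fc≤g : ∀ x → ℕ→ℚ (f x) * c ≤ ℕ→ℚ (g x)) where

  sum-map-scale-≤ : (xs : List A) → ℕ→ℚ (sum (map f xs)) * c ≤ ℕ→ℚ (sum (map g xs))
  sum-map-scale-≤ []       = ℚP.≤-trans (ℚP.≤-reflexive (ℚP.*-zeroˡ c)) (0≤ℕ→ℚ 0)
  sum-map-scale-≤ (x ∷ xs) = begin
    ℕ→ℚ (f x ℕ.+ sum (map f xs)) * c                 ≡⟨ cong (_* c) (ℕ→ℚ-+ (f x) _) ⟩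
    (ℕ→ℚ (f x) + ℕ→ℚ (sum (map f xs))) * c           ≡⟨ ℚP.*-distribʳ-+ c (ℕ→ℚ (f x)) _ ⟩
    ℕ→ℚ (f x) * c + ℕ→ℚ (sum (map f xs)) * c         ≤⟨ ℚP.+-mono-≤ (fc≤g x) (sum-map-scale-≤ xs) ⟩
    ℕ→ℚ (g x) + ℕ→ℚ (sum (map g xs))                 ≡⟨ ℕ→ℚ-+ (g x) _ ⟨
    ℕ→ℚ (g x ℕ.+ sum (map g xs))                     ∎
    where open ℚP.≤-Reasoning

does⇒ : {P : Set} (P? : Dec P) → T (does P?) → P
does⇒ (yes p) _ = p

0<ℕ→ℚ : ∀ {k} → 0 ℕ.< k → 0ℚ < ℕ→ℚ k
0<ℕ→ℚ {suc k} _ rewrite ℕ→ℚ≡mkℚ (suc k) = ℚ.*<* (ℤ.+<+ (s≤s z≤n))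

module _ (G : Graph) (ε δ : ℚ) where
  open Graph G

  threshold : ℚ
  threshold = (ε ^ 2) * ℕ→ℚ (numEdges G) * δ * (ℤ.+ 1 / 80)

  threshold-≤-degree : (v : Fin n) → T (heavy G ε δ v) → threshold ≤ ℕ→ℚ (degree G v)
  threshold-≤-degree v = does⇒ (threshold ℚP.≤? ℕ→ℚ (degree G v))

  missedIfHeavy-weighted : 0ℚ ≤ threshold → (s : ℕ) (v : Fin n) →
    ℕ→ℚ (missedIfHeavy G ε δ s v) * (ℕ→ℚ s * (threshold * threshold)) ≤ ℕ→ℚ (numEdges G ℕ.^ suc s ℕ.* degree G v)
  missedIfHeavy-weighted 0≤t s v = byHeaviness (heavy G ε δ v) (threshold-≤-degree v)
    where
    open ℚP.≤-Reasoning
    m = numEdges G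
    d = degree G v
    a = (m ∸ d) ℕ.^ s
    ℕ→ℚ-*³ : ℕ→ℚ (a ℕ.* (s ℕ.* (d ℕ.* d))) ≡ ℕ→ℚ a * (ℕ→ℚ s * (ℕ→ℚ d * ℕ→ℚ d))
    ℕ→ℚ-*³ = trans (ℕ→ℚ-* a _) (cong (ℕ→ℚ a *_) (trans (ℕ→ℚ-* s _) (cong (ℕ→ℚ s *_) (ℕ→ℚ-* d d))))
    reassoc : a ℕ.* (s ℕ.* (d ℕ.* d)) ≡ a ℕ.* (s ℕ.* d) ℕ.* d
    reassoc = trans (cong (a ℕ.*_) (sym (ℕP.*-assoc s d d))) (sym (ℕP.*-assoc a (s ℕ.* d) d))
    byHeaviness : (b : Bool) → (T b → threshold ≤ ℕ→ℚ d) →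
      ℕ→ℚ (if b then a else 0) * (ℕ→ℚ s * (threshold * threshold)) ≤ ℕ→ℚ (m ℕ.^ suc s ℕ.* d)
    byHeaviness false _   = ℚP.≤-trans (ℚP.≤-reflexive (ℚP.*-zeroˡ (ℕ→ℚ s * (threshold * threshold)))) (0≤ℕ→ℚ (m ℕ.^ suc s ℕ.* d))
    byHeaviness true  t≤d = begin
      ℕ→ℚ a * (ℕ→ℚ s * (threshold * threshold))  ≤⟨ *-monoˡ-≤-≥0 (0≤ℕ→ℚ a) (*-monoˡ-≤-≥0 (0≤ℕ→ℚ s) (*-self-mono-≤ 0≤t (t≤d tt))) ⟩
      ℕ→ℚ a * (ℕ→ℚ s * (ℕ→ℚ d * ℕ→ℚ d))         ≡⟨ ℕ→ℚ-*³ ⟨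
      ℕ→ℚ (a ℕ.* (s ℕ.* (d ℕ.* d)))              ≤⟨ ℕ→ℚ-mono-≤ (ℕP.≤-trans (ℕP.≤-reflexive reassoc) (ℕP.*-monoˡ-≤ d (bernoulli-∸ s (degree-≤-numEdges G v)))) ⟩
      ℕ→ℚ (m ℕ.^ suc s ℕ.* d)                     ∎

  badCount-weighted : 0ℚ ≤ threshold → (s : ℕ) →
    ℕ→ℚ (badCount G ε δ s) * (ℕ→ℚ s * (threshold * threshold)) ≤ ℕ→ℚ (numEdges G ℕ.^ suc s ℕ.* (numEdges G ℕ.* 2))
  badCount-weighted 0≤t s = begin
    ℕ→ℚ (badCount G ε δ s) * c                                   ≤⟨ *-monoʳ-≤-≥0 0≤c (ℕ→ℚ-mono-≤ (badCount-≤ G ε δ s)) ⟩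
    ℕ→ℚ (sum (map (missedIfHeavy G ε δ s) (allFin n))) * c       ≤⟨ sum-map-scale-≤ _ _ 0≤c (missedIfHeavy-weighted 0≤t s) (allFin n) ⟩
    ℕ→ℚ (sum (map (λ v → m ℕ.^ suc s ℕ.* degree G v) (allFin n))) ≡⟨ cong ℕ→ℚ (sum-map-*ˡ (m ℕ.^ suc s) (degree G) (allFin n)) ⟩
    ℕ→ℚ (m ℕ.^ suc s ℕ.* sum (map (degree G) (allFin n)))        ≤⟨ ℕ→ℚ-mono-≤ (ℕP.*-monoʳ-≤ (m ℕ.^ suc s) (handshake G)) ⟩
    ℕ→ℚ (m ℕ.^ suc s ℕ.* (m ℕ.* 2))                              ∎
    where
    open ℚP.≤-Reasoning
    m = numEdges G
    c = ℕ→ℚ s * (threshold * threshold)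
    0≤c : 0ℚ ≤ c
    0≤c = *-≥0 (0≤ℕ→ℚ s) (*-≥0 0≤t 0≤t)

badFraction-≤ : ∀ {B S M P ε δ} → 0ℚ < M → 0ℚ ≤ B → 0ℚ ≤ δ →
  B * (S * (((ε ^ 2) * M * δ * (ℤ.+ 1 / 80)) * ((ε ^ 2) * M * δ * (ℤ.+ 1 / 80)))) ≤ M * P * (M * ℕ→ℚ 2) →
  ℕ→ℚ 51200 ≤ S * (δ ^ 3 * ε ^ 4) →
  B ≤ δ * (ℤ.+ 1 / 4) * P
badFraction-≤ {B} {S} {M} {P} {ε} {δ} 0<M 0≤B 0≤δ weighted enough = begin
  B                                    ≡⟨ solve 1 (λ B → B := B :* con (ℕ→ℚ 51200) :* con (ℤ.+ 1 / 51200)) refl B ⟩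
  B * ℕ→ℚ 51200 * (ℤ.+ 1 / 51200)      ≤⟨ *-monoʳ-≤-≥0 0≤1/51200 (*-monoˡ-≤-≥0 0≤B enough) ⟩
  B * X * (ℤ.+ 1 / 51200)              ≤⟨ *-monoʳ-≤-≥0 0≤1/51200 BX≤ ⟩
  ℕ→ℚ 12800 * δ * P * (ℤ.+ 1 / 51200)  ≡⟨ solve 2 (λ δ P → con (ℕ→ℚ 12800) :* δ :* P :* con (ℤ.+ 1 / 51200) := δ :* con (ℤ.+ 1 / 4) :* P) refl δ P ⟩
  δ * (ℤ.+ 1 / 4) * P                  ∎
  where
  open ℚP.≤-Reasoning
  open ℚS.+-*-Solver
  X = S * (δ ^ 3 * ε ^ 4)
  0≤1/51200 : 0ℚ ≤ ℤ.+ 1 / 51200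
  0≤1/51200 = ℚP.<⇒≤ (ℚP.positive⁻¹ (ℤ.+ 1 / 51200))
  -- Multiplying by 6400 δ turns S T² into S δ³ ε⁴ M², so that M² can be cancelled.
  BX≤ : B * X ≤ ℕ→ℚ 12800 * δ * P
  BX≤ = ℚP.*-cancelˡ-≤-pos (M * M) {{ℚP.pos*pos⇒pos M {{ℚ.positive 0<M}} M {{ℚ.positive 0<M}}}} (begin
    M * M * (B * X)                      ≡⟨ solve 5 (λ B S M ε δ → M :* M :* (B :* (S :* (δ :^ 3 :* ε :^ 4)))
                                              := B :* (S :* (ε :^ 2 :* M :* δ :* con (ℤ.+ 1 / 80) :* (ε :^ 2 :* M :* δ :* con (ℤ.+ 1 / 80))))
                                                 :* (δ :* con (ℕ→ℚ 6400))) refl B S M ε δ ⟩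
    B * (S * (t * t)) * (δ * ℕ→ℚ 6400)   ≤⟨ *-monoʳ-≤-≥0 (*-≥0 0≤δ (0≤ℕ→ℚ 6400)) weighted ⟩
    M * P * (M * ℕ→ℚ 2) * (δ * ℕ→ℚ 6400) ≡⟨ solve 3 (λ M P δ → M :* P :* (M :* con (ℕ→ℚ 2)) :* (δ :* con (ℕ→ℚ 6400))
                                              := M :* M :* (con (ℕ→ℚ 12800) :* δ :* P)) refl M P δ ⟩
    M * M * (ℕ→ℚ 12800 * δ * P)          ∎)
    where t = (ε ^ 2) * M * δ * (ℤ.+ 1 / 80)

complement-≥ : ∀ {g b p x} → g + b ≡ p → b ≤ x * p → (1ℚ - x) * p ≤ g
complement-≥ {g} {b} {p} {x} refl b≤xp = begin
  (1ℚ - x) * (g + b)                 ≡⟨ solve 3 (λ g b x → (con 1ℚ :- x) :* (g :+ b) := g :+ (b :- x :* (g :+ b))) refl g b x ⟩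
  g + (b - x * (g + b))              ≤⟨ ℚP.+-monoʳ-≤ g (ℚP.+-monoˡ-≤ (ℚ.- (x * (g + b))) b≤xp) ⟩
  g + (x * (g + b) - x * (g + b))    ≡⟨ cong (g +_) (ℚP.+-inverseʳ (x * (g + b))) ⟩
  g + 0ℚ                             ≡⟨ ℚP.+-identityʳ g ⟩
  g                                  ∎
  where
  open ℚP.≤-Reasoning
  open ℚS.+-*-Solver

module _ (β : ℚ) {ε δ : ℚ} (0<ε : 0ℚ < ε) (0<δ : 0ℚ < δ) where

  ≤-ceilℕ-rescaled : β ≤ ℕ→ℚ (ceilℕ (β * (inv δ 0<δ ^ 3) * (inv ε 0<ε ^ 4))) * (δ ^ 3 * ε ^ 4)
  ≤-ceilℕ-rescaled = begin
    β                                                      ≡⟨ rescaled ⟨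
    β * (u ^ 3) * (w ^ 4) * (δ ^ 3 * ε ^ 4)                ≤⟨ *-monoʳ-≤-≥0 (*-≥0 (^-≥0 3 (ℚP.<⇒≤ 0<δ)) (^-≥0 4 (ℚP.<⇒≤ 0<ε))) (ceilℕ-≥ (β * (u ^ 3) * (w ^ 4))) ⟩
    ℕ→ℚ (ceilℕ (β * (u ^ 3) * (w ^ 4))) * (δ ^ 3 * ε ^ 4)  ∎
    where
    open ℚP.≤-Reasoning
    open ℚS.+-*-Solver
    u = inv δ 0<δ
    w = inv ε 0<ε
    rescaled : β * (u ^ 3) * (w ^ 4) * (δ ^ 3 * ε ^ 4) ≡ β
    rescaled = begin-equality
      β * (u ^ 3) * (w ^ 4) * (δ ^ 3 * ε ^ 4) ≡⟨ solve 5 (λ β u w δ ε → β :* (u :^ 3) :* (w :^ 4) :* (δ :^ 3 :* ε :^ 4) := β :* ((u :* δ) :^ 3 :* (w :* ε) :^ 4)) refl β u w δ ε ⟩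
      β * ((u * δ) ^ 3 * (w * ε) ^ 4)         ≡⟨ cong₂ (λ a b → β * (a ^ 3 * b ^ 4)) (ℚP.*-inverseˡ δ {{ℚP.pos⇒nonZero δ {{ℚ.positive 0<δ}}}}) (ℚP.*-inverseˡ ε {{ℚP.pos⇒nonZero ε {{ℚ.positive 0<ε}}}}) ⟩
      β * 1ℚ                                  ≡⟨ ℚP.*-identityʳ β ⟩
      β                                       ∎

0^n≡0 : ∀ {k} → 0 ℕ.< k → 0 ℕ.^ k ≡ 0
0^n≡0 {suc k} _ = refl

0<sampleSize : ∀ {X} k → ℕ→ℚ 51200 ≤ ℕ→ℚ k * X → 0 ℕ.< k
0<sampleSize {X} zero    enough = ⊥-elim (ℚP.<-irrefl refl (ℚP.<-≤-trans (0<ℕ→ℚ {51200} (s≤s z≤n))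
  (ℚP.≤-trans enough (ℚP.≤-reflexive (ℚP.*-zeroˡ X)))))
0<sampleSize     (suc k) _      = s≤s z≤n

module _ {ε δ : ℚ} (0≤ε : 0ℚ ≤ ε) (0≤δ : 0ℚ ≤ δ) (G : Graph) (s : ℕ)
         (enough : ℕ→ℚ 51200 ≤ ℕ→ℚ s * (δ ^ 3 * ε ^ 4)) where
  private
    m = numEdges G
    b = badCount G ε δ s

  badCount-≤-fraction : 0 ℕ.< m → ℕ→ℚ b ≤ δ * (ℤ.+ 1 / 4) * ℕ→ℚ (m ℕ.^ s)
  badCount-≤-fraction 0<m =
    badFraction-≤ {ℕ→ℚ b} {ℕ→ℚ s} {ℕ→ℚ m} {ℕ→ℚ (m ℕ.^ s)} {ε} {δ} (0<ℕ→ℚ 0<m) (0≤ℕ→ℚ b) 0≤δ weighted enough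
    where
    0≤threshold : 0ℚ ≤ threshold G ε δ
    0≤threshold = *-≥0 (*-≥0 (*-≥0 (^-≥0 2 0≤ε) (0≤ℕ→ℚ m)) 0≤δ) (ℚP.<⇒≤ (ℚP.positive⁻¹ (ℤ.+ 1 / 80)))
    weighted : ℕ→ℚ b * (ℕ→ℚ s * (threshold G ε δ * threshold G ε δ)) ≤ ℕ→ℚ m * ℕ→ℚ (m ℕ.^ s) * (ℕ→ℚ m * ℕ→ℚ 2)
    weighted = subst (ℕ→ℚ b * (ℕ→ℚ s * (threshold G ε δ * threshold G ε δ)) ≤_)
      (trans (ℕ→ℚ-* (m ℕ.^ suc s) (m ℕ.* 2)) (cong₂ _*_ (ℕ→ℚ-* m (m ℕ.^ s)) (ℕ→ℚ-* m 2)))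
      (badCount-weighted G ε δ 0≤threshold s)

  goodCount-≥ : (1ℚ - δ * (ℤ.+ 1 / 4)) * ℕ→ℚ (m ℕ.^ s) ≤ ℕ→ℚ (goodCount G ε δ s)
  goodCount-≥ = byEdgeCount (m ℕP.≟ 0)
    where
    open ℚP.≤-Reasoning
    good+bad≡ : ℕ→ℚ (goodCount G ε δ s) + ℕ→ℚ b ≡ ℕ→ℚ (m ℕ.^ s)
    good+bad≡ = trans (sym (ℕ→ℚ-+ (goodCount G ε δ s) b)) (cong ℕ→ℚ (goodCount+badCount G ε δ s))
    byEdgeCount : Dec (m ≡ 0) → (1ℚ - δ * (ℤ.+ 1 / 4)) * ℕ→ℚ (m ℕ.^ s) ≤ ℕ→ℚ (goodCount G ε δ s)
    byEdgeCount (no m≢0)  = complement-≥ {x = δ * (ℤ.+ 1 / 4)} good+bad≡ (badCount-≤-fraction (ℕP.n≢0⇒n>0 m≢0))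
    byEdgeCount (yes m≡0) = begin
      (1ℚ - δ * (ℤ.+ 1 / 4)) * ℕ→ℚ (m ℕ.^ s)  ≡⟨ cong (λ k → (1ℚ - δ * (ℤ.+ 1 / 4)) * ℕ→ℚ (k ℕ.^ s)) m≡0 ⟩
      (1ℚ - δ * (ℤ.+ 1 / 4)) * ℕ→ℚ (0 ℕ.^ s)  ≡⟨ cong (λ k → (1ℚ - δ * (ℤ.+ 1 / 4)) * ℕ→ℚ k) (0^n≡0 (0<sampleSize s enough)) ⟩
      (1ℚ - δ * (ℤ.+ 1 / 4)) * 0ℚ             ≡⟨ ℚP.*-zeroʳ (1ℚ - δ * (ℤ.+ 1 / 4)) ⟩
      0ℚ                                      ≤⟨ 0≤ℕ→ℚ (goodCount G ε δ s) ⟩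
      ℕ→ℚ (goodCount G ε δ s)                 ∎

-- K = 0: no lower bound on m is needed, nor are the hypotheses ε ≤ 1/2 and δ < 1.
mainTheorem12 :
    ∃[ β₀ ] ∀ (β : ℚ) → β₀ ≤ β →
    ∃[ K ] ∀ (ε δ : ℚ) (0<ε : 0ℚ < ε) → ε ≤ ℤ.+ 1 / 2 → (0<δ : 0ℚ < δ) → δ < 1ℚ →
      ∀ (G : Graph) →
      K * (inv ε 0<ε ^ 11) * (inv δ 0<δ ^ 7) ≤ ℕ→ℚ (numEdges G) →
      (1ℚ - δ * (ℤ.+ 1 / 4)) * ℕ→ℚ (numEdges G ℕ.^ ceilℕ (β * (inv δ 0<δ ^ 3) * (inv ε 0<ε ^ 4)))
        ≤ ℕ→ℚ (goodCount G ε δ (ceilℕ (β * (inv δ 0<δ ^ 3) * (inv ε 0<ε ^ 4))))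
mainTheorem12 = ℕ→ℚ 51200 , λ β 51200≤β → 0ℚ , λ ε δ 0<ε _ 0<δ _ G _ →
  goodCount-≥ (ℚP.<⇒≤ 0<ε) (ℚP.<⇒≤ 0<δ) G (ceilℕ (β * (inv δ 0<δ ^ 3) * (inv ε 0<ε ^ 4)))
    (ℚP.≤-trans 51200≤β (≤-ceilℕ-rescaled β 0<ε 0<δ))
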